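{- Let $\chi:[\omega]^2\rightarrow\omega$ be a $2$-bounded coloring, let $A\subseteq\omega$ be normal for $\chi$, and let $I$ be an ideal on $\omega$ containing all finite sets. Let $X\subseteq A$ be polychromatic for $\chi$ with $|X|\leq n$. If $E(X)\cap A\notin I$, then the set $\{a\in A\cap E(X): A\cap E(X\cup\{a\})\in I\}$ has at most $n$ elements.
   Context: A coloring $\chi:[\omega]^2\rightarrow\omega$ is $2$-bounded if each color is assigned to at most two pairs; write $\chi(a,b)$ for $\chi(\{a,b\})$. A set $Y$ is polychromatic for $\chi$ if distinct pairs from $Y$ receive distinct colors. A set $A\subseteq\omega$ is normal (for $\chi$) if whenever $a_0<a_1$ and $b_0<b_1$ are in $A$ with $\chi(a_0,a_1)=\chi(b_0,b_1)$, then $a_1=b_1$. For finite polychromatic $X$, $E(X)=\{a\in\omega: X\cup\{a\}\text{ is polychromatic}\}$. -}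

module Defs where

open import Data.Nat using (ℕ; _<_; _≤_)
open import Data.Product using (_×_; ∃-syntax)
open import Data.Sum using (_⊎_)
open import Data.List using (List; _∷_; length)
open import Data.List.Membership.Propositional using (_∈_)
open import Data.List.Relation.Unary.All using (All)
open import Data.List.Relation.Unary.Unique.Propositional using (Unique)
open import Relation.Binary.PropositionalEquality using (_≡_)

-- A coloring χ : [ω]² → ω.  The pair {a,b} with a < b receives colour χ a b;
-- values χ a b with a ≥ b are never used.
Coloring : Set
Coloring = ℕ → ℕ → ℕ

Subset : Set₁
Subset = ℕ → Set

_⊆_ : Subset → Subset → Set
S ⊆ T = ∀ x → S x → T x

_∪_ : Subset → Subset → Subset
(S ∪ T) x = S x ⊎ T x

_∩_ : Subset → Subset → Subset
(S ∩ T) x = S x × T x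

⟦_⟧ : List ℕ → Subset
⟦ X ⟧ x = x ∈ X

IsFinite : Subset → Set
IsFinite S = ∃[ N ] (∀ x → S x → x < N)

-- 2-bounded: each colour is assigned to at most two pairs.
TwoBounded : Coloring → Set
TwoBounded χ = ∀ a₀ a₁ b₀ b₁ c₀ c₁ → a₀ < a₁ → b₀ < b₁ → c₀ < c₁ →
  χ a₀ a₁ ≡ χ b₀ b₁ → χ a₀ a₁ ≡ χ c₀ c₁ →
  (a₀ ≡ b₀ × a₁ ≡ b₁) ⊎ (a₀ ≡ c₀ × a₁ ≡ c₁) ⊎ (b₀ ≡ c₀ × b₁ ≡ c₁)

Polychromatic : Coloring → Subset → Set
Polychromatic χ Y = ∀ a₀ a₁ b₀ b₁ → Y a₀ → Y a₁ → Y b₀ → Y b₁ →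
  a₀ < a₁ → b₀ < b₁ → χ a₀ a₁ ≡ χ b₀ b₁ → a₀ ≡ b₀ × a₁ ≡ b₁

Normal : Coloring → Subset → Set
Normal χ A = ∀ a₀ a₁ b₀ b₁ → A a₀ → A a₁ → A b₀ → A b₁ →
  a₀ < a₁ → b₀ < b₁ → χ a₀ a₁ ≡ χ b₀ b₁ → a₁ ≡ b₁

E : Coloring → List ℕ → Subset
E χ X a = Polychromatic χ ⟦ a ∷ X ⟧

record IdealWithFin (I : Subset → Set) : Set₁ where
  field
    downward : ∀ S T → S ⊆ T → I T → I S
    union    : ∀ S T → I S → I T → I (S ∪ T)
    finite   : ∀ S → IsFinite S → I S

AtMost : ℕ → Subset → Set
AtMost n S = ∀ (L : List ℕ) → Unique L → All S L → length L ≤ n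

-- Let L be a duplicate-free list of "bad" points a ∈ A ∩ E(X), i.e. points
-- with A ∩ E(X ∪ {a}) ∈ I.  Pick N above every element of
-- L and X and take b ∈ A ∩ E(X) with b ≥ N.  For each a ∈ L either
--   * no x ∈ X other than a satisfies χ(x,b) = χ(a,b); then, since A is
--     normal and b is the maximum of X ∪ {a,b}, the set X ∪ {a,b} is
--     polychromatic, i.e. b ∈ E(X ∪ {a}); or
--   * some x ∈ X \ {a} "collides" with a at b: χ(x,b) = χ(a,b).
-- By 2-boundedness a collision partner x determines a, so if every a ∈ L
-- collides then |L| ≤ |X| ≤ n (a pigeonhole argument).  Hence if |L| > n,
-- every large b ∈ A ∩ E(X) lies in ⋃_{a ∈ L} A ∩ E(X ∪ {a}), so A ∩ E(X) is
-- covered by a finite set and finitely many members of I, and therefore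
-- lies in I — contradicting the hypothesis.
module Submission where

open import Defs
open import Data.Nat using (ℕ; _≤_; _<_; suc; _+_; z≤n; s≤s; _≟_; _<?_; _≤?_)
open import Data.Nat.Properties using (<-irrefl; <-trans; <-≤-trans; ≤-trans; m≤m+n; m≤n+m; ≮⇒≥)
open import Data.Product using (_×_; _,_; proj₁; proj₂)
open import Data.Sum using (_⊎_; inj₁; inj₂; [_,_]; map₂)
open import Data.Empty using (⊥; ⊥-elim)
open import Data.List using (List; []; _∷_; length; _++_)
open import Data.List.Properties using (length-removeAt′)
open import Data.List.Membership.Propositional using (_∈_; lose)
open import Data.List.Membership.Propositional.Properties using (∈-++⁺ˡ; ∈-++⁺ʳ)
open import Data.List.Relation.Unary.Any using (Any; here; there; _─_; index; any?)
open import Data.List.Relation.Unary.All as All using (All; []; _∷_)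
open import Data.List.Relation.Unary.Unique.Propositional using (Unique)
open import Data.List.Relation.Unary.AllPairs using ([]; _∷_)
open import Function using (id)
open import Relation.Binary.PropositionalEquality using (_≡_; _≢_; refl; sym; trans; subst)
open import Relation.Nullary using (¬_; yes; no; ¬?)
open import Relation.Nullary.Decidable using (_×-dec_)

any-─ : ∀ {A : Set} {P Q : A → Set} {xs : List A} (p : Any P xs) → Any Q xs →
        (∀ {x} → P x → Q x → ⊥) → Any Q (xs ─ p)
any-─ (here px)  (here qx)  disjoint = ⊥-elim (disjoint px qx)
any-─ (here _)   (there qs) _        = qs
any-─ (there _)  (here qx)  _        = here qx
any-─ (there ps) (there qs) disjoint = there (any-─ ps qs disjoint)

-- Each a consumes its own witness, which is removed from X.
pigeonhole : ∀ {A B : Set} {R : A → B → Set} →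
             (∀ {a a′ x} → R a x → R a′ x → a ≡ a′) →
             ∀ {L X} → Unique L → All (λ a → Any (R a) X) L → length L ≤ length X
pigeonhole inj {[]} [] [] = z≤n
pigeonhole {R = R} inj {a ∷ L} {X} (a∉L ∷ uL) (p ∷ ps) =
  subst (suc (length L) ≤_) (sym (length-removeAt′ X (index p)))
        (s≤s (pigeonhole inj uL (All.zipWith shrink (a∉L , ps))))
  where
  shrink : ∀ {a′} → a ≢ a′ × Any (R a′) X → Any (R a′) (X ─ p)
  shrink (a≢a′ , q) = any-─ p q (λ r r′ → a≢a′ (inj r r′))

list-finite : ∀ xs → IsFinite ⟦ xs ⟧
list-finite []       = 0 , λ _ ()
list-finite (x ∷ xs) with list-finite xs
... | N , below = suc x + N , bound
  where
  bound : ∀ y → y ∈ x ∷ xs → y < suc x + N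
  bound y (here refl) = s≤s (m≤m+n x N)
  bound y (there m)   = <-≤-trans (below y m) (m≤n+m N (suc x))

some-or-all : ∀ {A : Set} {R Q : A → Set} {L} → All (λ a → R a ⊎ Q a) L → Any R L ⊎ All Q L
some-or-all []             = inj₂ []
some-or-all (inj₁ r ∷ _)   = inj₁ (here r)
some-or-all (inj₂ q ∷ rqs) with some-or-all rqs
... | inj₁ r  = inj₁ (there r)
... | inj₂ qs = inj₂ (q ∷ qs)

ideal-⋃ : ∀ {I} → IdealWithFin I → {F : ℕ → Subset} →
          ∀ L → All (λ a → I (F a)) L → I (λ b → Any (λ a → F a b) L)
ideal-⋃ ideal []      []         = finite _ (0 , λ _ ())
  where open IdealWithFin ideal
ideal-⋃ ideal {F} (a ∷ L) (IFa ∷ IFs) =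
  downward _ _ split (union _ _ IFa (ideal-⋃ ideal L IFs))
  where
  open IdealWithFin ideal
  split : ∀ b → Any (λ a′ → F a′ b) (a ∷ L) → (F a ∪ (λ b′ → Any (λ a′ → F a′ b′) L)) b
  split b (here  h) = inj₁ h
  split b (there t) = inj₂ t

module _ (χ : Coloring) where

  -- Adding a new maximum b to a polychromatic subset Z of a normal set A
  -- keeps it polychromatic as soon as the new edges {c,b}, c ∈ Z, have
  -- pairwise distinct colours: normality forbids an edge ending in b from
  -- sharing its colour with an edge inside Z.
  extend-by-maximum : ∀ {A} → Normal χ A → ∀ {Z b} → All A Z → A b → All (_< b) Z →
    Polychromatic χ ⟦ Z ⟧ → (∀ {c d} → c ∈ Z → d ∈ Z → χ c b ≡ χ d b → c ≡ d) →
    Polychromatic χ ⟦ b ∷ Z ⟧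
  extend-by-maximum {A} normal {Z} {b} AZ Ab Z<b polyZ star = poly
    where
    inA : ∀ {c} → c ∈ b ∷ Z → A c
    inA (here refl) = Ab
    inA (there m)   = All.lookup AZ m

    lower : ∀ {c} → c < b → c ∈ b ∷ Z → c ∈ Z
    lower c<b (here refl) = ⊥-elim (<-irrefl refl c<b)
    lower _   (there m)   = m

    poly : Polychromatic χ ⟦ b ∷ Z ⟧
    poly c₀ c₁ d₀ d₁ m₀ (there m₁) n₀ (there n₁) c₀<c₁ d₀<d₁ same =
      polyZ c₀ c₁ d₀ d₁ (lower (<-trans c₀<c₁ (All.lookup Z<b m₁)) m₀) m₁
                        (lower (<-trans d₀<d₁ (All.lookup Z<b n₁)) n₀) n₁ c₀<c₁ d₀<d₁ same
    poly c₀ _ d₀ d₁ m₀ (here refl) n₀ (there n₁) c₀<b d₀<d₁ same =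
      ⊥-elim (<-irrefl (sym (normal c₀ b d₀ d₁ (inA m₀) Ab (inA n₀) (inA (there n₁)) c₀<b d₀<d₁ same))
                       (All.lookup Z<b n₁))
    poly c₀ c₁ d₀ _ m₀ (there m₁) n₀ (here refl) c₀<c₁ d₀<b same =
      ⊥-elim (<-irrefl (normal c₀ c₁ d₀ b (inA m₀) (inA (there m₁)) (inA n₀) Ab c₀<c₁ d₀<b same)
                       (All.lookup Z<b m₁))
    poly c₀ _ d₀ _ m₀ (here refl) n₀ (here refl) c₀<b d₀<b same =
      star (lower c₀<b m₀) (lower d₀<b n₀) same , refl

  Collision : ℕ → ℕ → ℕ → Set
  Collision b a x = x ≢ a × a < b × x < b × χ a b ≡ χ x b

  -- In a 2-bounded colouring a collision partner determines a: otherwise the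
  -- three distinct edges {a,b}, {x,b}, {a′,b} would share a colour.
  collision-injective : TwoBounded χ → ∀ {b a a′ x} →
                        Collision b a x → Collision b a′ x → a ≡ a′
  collision-injective twoBounded {b} {a} {a′} {x} (x≢a , a<b , x<b , e) (x≢a′ , a′<b , _ , e′)
    with twoBounded a b x b a′ b a<b x<b a′<b e (trans e (sym e′))
  ... | inj₁ (a≡x , _)          = ⊥-elim (x≢a (sym a≡x))
  ... | inj₂ (inj₁ (a≡a′ , _))  = a≡a′
  ... | inj₂ (inj₂ (x≡a′ , _))  = ⊥-elim (x≢a′ x≡a′)

  extends-or-collides : ∀ {A} → Normal χ A → ∀ {X a b} → All A X → All (_< b) X →
    A a → E χ X a → a < b → A b → E χ X b →
    (A ∩ E χ (a ∷ X)) b ⊎ Any (Collision b a) X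
  extends-or-collides normal {X} {a} {b} AX X<b Aa Ea a<b Ab Eb
    with any? (λ x → ¬? (x ≟ a) ×-dec a <? b ×-dec x <? b ×-dec χ a b ≟ χ x b) X
  ... | yes collision = inj₂ collision
  ... | no noCollision =
    inj₁ (Ab , extend-by-maximum normal (Aa ∷ AX) Ab (a<b ∷ X<b) Ea star)
    where
    only-a : ∀ {x} → x ∈ X → χ a b ≡ χ x b → x ≡ a
    only-a {x} x∈X same with x ≟ a
    ... | yes x≡a = x≡a
    ... | no  x≢a = ⊥-elim (noCollision (lose x∈X (x≢a , a<b , All.lookup X<b x∈X , same)))

    star : ∀ {c d} → c ∈ a ∷ X → d ∈ a ∷ X → χ c b ≡ χ d b → c ≡ d
    star (here refl) (here refl) _    = refl
    star (here refl) (there d∈X) same = sym (only-a d∈X same)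
    star (there c∈X) (here refl) same = only-a c∈X (sym same)
    star (there c∈X) (there d∈X) same =
      proj₁ (Eb _ b _ b (there c∈X) (here refl) (there d∈X) (here refl)
                 (All.lookup X<b c∈X) (All.lookup X<b d∈X) same)

  covered-or-few : TwoBounded χ → ∀ {A} → Normal χ A → ∀ {X L b} → All A X → Unique L →
    All (λ a → A a × E χ X a) L → All (_< b) L → All (_< b) X → A b → E χ X b →
    Any (λ a → (A ∩ E χ (a ∷ X)) b) L ⊎ length L ≤ length X
  covered-or-few twoBounded normal AX uL good L<b X<b Ab Eb =
    map₂ (pigeonhole (collision-injective twoBounded) uL)
      (some-or-all (All.zipWith
        (λ { ((Aa , Ea) , a<b) → extends-or-collides normal AX X<b Aa Ea a<b Ab Eb })
        (good , L<b)))

mainTheorem13 : (χ : Coloring) → TwoBounded χ →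
    (A : Subset) → Normal χ A →
    (I : Subset → Set) → IdealWithFin I →
    (n : ℕ) (X : List ℕ) → Unique X → All A X → Polychromatic χ ⟦ X ⟧ →
    length X ≤ n →
    ¬ I (E χ X ∩ A) →
    AtMost n (λ a → A a × E χ X a × I (A ∩ E χ (a ∷ X)))
mainTheorem13 χ twoBounded A normal I ideal n X _ AX _ |X|≤n EX∉I L uL bad with length L ≤? n
... | yes |L|≤n = |L|≤n
... | no  |L|≰n = ⊥-elim (EX∉I (downward _ _ covered
      (union _ _ (finite _ (N , λ _ b<N → b<N)) (ideal-⋃ ideal L (All.map (λ (_ , _ , IF) → IF) bad)))))
  where
  open IdealWithFin ideal
  N : ℕ
  N = proj₁ (list-finite (L ++ X))

  N-bound : ∀ c → c ∈ L ++ X → c < N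
  N-bound = proj₂ (list-finite (L ++ X))

  covered : (E χ X ∩ A) ⊆ ((_< N) ∪ (λ b → Any (λ a → (A ∩ E χ (a ∷ X)) b) L))
  covered b (Eb , Ab) with b <? N
  ... | yes b<N = inj₁ b<N
  ... | no  b≮N = inj₂ ([ id , (λ |L|≤|X| → ⊥-elim (|L|≰n (≤-trans |L|≤|X| |X|≤n))) ]
      (covered-or-few χ twoBounded normal AX uL (All.map (λ (Aa , Ea , _) → Aa , Ea) bad)
        (All.tabulate (λ m → below (∈-++⁺ˡ m))) (All.tabulate (λ m → below (∈-++⁺ʳ L m))) Ab Eb))
    where
    below : ∀ {c} → c ∈ L ++ X → c < b
    below m = <-≤-trans (N-bound _ m) (≮⇒≥ b≮N)
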